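{- Let \(m,b,s\) be positive integers with \(m \le s-2\) and \(m \le b\). Let \(H\) be an \(s\)-uniform hypergraph which is a vertex-disjoint union of trees and unicycles. Then Breaker has a winning strategy in the \((m,b)\)-Maker-Breaker game on \(H\).
   Context: A hypergraph is a pair \(H=(V,E)\) with \(V\) finite and \(E \subseteq 2^V\); it is \(s\)-uniform if all edges have size \(s\). \(H\) is connected if for all \(x,y \in V\) there are edges \(e_1,\dots,e_k\) with \(x \in e_1\), \(y \in e_k\) and \(e_i \cap e_{i+1} \neq \emptyset\) for all \(i\). The excess of an \(s\)-uniform hypergraph \(H=(V,E)\) is \(ex(H) = (s-1)|E| - |V|\). A tree is a connected \(s\)-uniform hypergraph with excess \(-1\); a unicycle is a connected \(s\)-uniform hypergraph with excess \(0\). The \((m,b)\)-Maker-Breaker game on \(H\): Maker and Breaker alternately pick unpicked vertices of \(V\), Maker \(m\) per turn and Breaker \(b\) per turn (fewer if fewer remain), Maker first, until all vertices are picked; Maker wins if his vertices contain an edge of \(H\), otherwise Breaker wins. -}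

module Defs where

open import Data.Nat using (ℕ; zero; suc; _∸_; _*_; _⊓_; _<_)
open import Data.Integer as ℤ using (ℤ; +_; _-_; -[1+_])
open import Data.Fin using (Fin)
open import Data.Fin.Properties using (_≟_)
open import Data.Fin.Subset using (Subset; _∈_; _⊆_; _∪_; ∁; ∣_∣; ⊥)
open import Data.Fin.Subset.Properties using (_⊆?_)
open import Data.List using (List; length; filter)
open import Data.List.Membership.Propositional renaming (_∈_ to _∈ₗ_)
open import Data.List.Relation.Unary.Unique.Propositional using (Unique)
open import Data.Vec using (tabulate)
open import Data.Product using (Σ; ∃; _×_)
open import Data.Sum using (_⊎_)
open import Relation.Nullary using (¬_; does)
open import Relation.Binary.PropositionalEquality using (_≡_)

-- A hypergraph on vertex set V = Fin n is given by its edge list E; that E is a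
-- set (no repeated edges) is imposed by the hypothesis 'Unique E' where needed.

Uniform : ∀ {n} → ℕ → List (Subset n) → Set
Uniform s E = ∀ e → e ∈ₗ E → ∣ e ∣ ≡ s

excess : ∀ {n} → ℕ → Subset n → List (Subset n) → ℤ
excess s V E = + ((s ∸ 1) * length E) - + ∣ V ∣

data EdgeChain {n} (E : List (Subset n)) : Fin n → Fin n → Set where
  one  : ∀ {x y e} → e ∈ₗ E → x ∈ e → y ∈ e → EdgeChain E x y
  cons : ∀ {x z y e} → e ∈ₗ E → x ∈ e → z ∈ e → EdgeChain E z y → EdgeChain E x y

Connected : ∀ {n} → Subset n → List (Subset n) → Set
Connected V E = ∀ x y → x ∈ V → y ∈ V → EdgeChain E x y

IsTree : ∀ {n} → ℕ → Subset n → List (Subset n) → Set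
IsTree s V E = Uniform s E × Connected V E × (excess s V E ≡ -[1+ 0 ])

IsUnicycle : ∀ {n} → ℕ → Subset n → List (Subset n) → Set
IsUnicycle s V E = Uniform s E × Connected V E × (excess s V E ≡ + 0)

Part : ∀ {n k} → (Fin n → Fin k) → Fin k → Subset n
Part c i = tabulate (λ v → does (c v ≟ i))

PartEdges : ∀ {n k} → List (Subset n) → (Fin n → Fin k) → Fin k → List (Subset n)
PartEdges E c i = filter (_⊆? Part c i) E

UnionOfTreesAndUnicycles : ∀ {n} → ℕ → List (Subset n) → Set
UnionOfTreesAndUnicycles {n} s E =
  Σ ℕ λ k → Σ (Fin n → Fin k) λ c →
    (∀ e → e ∈ₗ E → ∃ λ i → e ⊆ Part c i) ×
    (∀ i → IsTree s (Part c i) (PartEdges E c i) ⊎ IsUnicycle s (Part c i) (PartEdges E c i))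

-- The (m,b)-Maker-Breaker game on (Fin n, E).  A position is the pair (M, B) of
-- vertex sets claimed so far by Maker and Breaker.
module Game {n : ℕ} (E : List (Subset n)) (m b : ℕ) where

  Free : Subset n → Subset n → Subset n
  Free M B = ∁ (M ∪ B)

  NoEdgeIn : Subset n → Set
  NoEdgeIn M = ∀ e → e ∈ₗ E → ¬ (e ⊆ M)

  -- A move claims exactly min(m, #free) (resp. min(b, #free)) free vertices; the
  -- game ends when no vertex is free, and Breaker wins iff Maker owns no edge.
  data BreakerWinsMakerToMove (M B : Subset n) : Set
  data BreakerWinsBreakerToMove (M B : Subset n) : Set

  data BreakerWinsMakerToMove M B where
    over : ∣ Free M B ∣ ≡ 0 → NoEdgeIn M → BreakerWinsMakerToMove M B
    move : 0 < ∣ Free M B ∣ →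
           (∀ S → S ⊆ Free M B → ∣ S ∣ ≡ m ⊓ ∣ Free M B ∣ →
                  BreakerWinsBreakerToMove (M ∪ S) B) →
           BreakerWinsMakerToMove M B

  data BreakerWinsBreakerToMove M B where
    over : ∣ Free M B ∣ ≡ 0 → NoEdgeIn M → BreakerWinsBreakerToMove M B
    move : 0 < ∣ Free M B ∣ →
           (Σ (Subset n) λ S → S ⊆ Free M B × ∣ S ∣ ≡ b ⊓ ∣ Free M B ∣ ×
                  BreakerWinsMakerToMove M (B ∪ S)) →
           BreakerWinsBreakerToMove M B

  BreakerWins : Set
  BreakerWins = BreakerWinsMakerToMove ⊥ ⊥

open Game public using (BreakerWins)

module Submission where

-- Suppose every edge e owns a private set of more than m of its vertices, private sets being
-- pairwise disjoint. Breaker keeps each edge blocked: either he holds a vertex of its private set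
-- that Maker does not, or Maker holds none of it. When Maker's move touches the private set of an
-- edge that is not yet blocked by Breaker, Breaker answers with a free vertex of that set; Maker
-- touches at most m ≤ b private sets per move, and since a private set has more than m vertices
-- such a free vertex exists. Hence Maker never fills a private set, let alone an edge.
--
-- Private sets of size s - 1 ≥ m + 1 exist in every tree and unicycle. Order the edges so that
-- each meets the union of the earlier ones; then each edge after the first brings at most s - 1
-- new vertices. In a tree the vertex count forces exactly s - 1 new vertices for every later edge,
-- which become its private set, while the first edge leaves out one vertex. In a unicycle exactly
-- one edge brings only s - 2 new vertices; the edges before it form a tree, rooted at a vertex
-- they share with it, and that edge adds the root to its private set.

open import Defs
open import Data.Bool.Properties using () renaming (_≟_ to _≟ᵇ_)
open import Data.Empty using (⊥-elim)
open import Data.Fin using (Fin; zero; suc)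
open import Data.Fin.Properties using () renaming (_≟_ to _≟ᶠ_)
open import Data.Fin.Subset
open import Data.Fin.Subset.Properties
  using (_∈?_; _⊆?_; nonempty?; ∉⊥; ∣⊥∣≡0; ∣p∣≤n; x∈⁅x⁆; x∈⁅y⁆⇒x≡y; ∣⁅x⁆∣≡1; x∈p∪q⁻; x∈p∪q⁺;
         x∈p∩q⁺; x∈p∩q⁻; p⊆p∪q; q⊆p∪q; p∩q⊆q; p─q⊆p; x∈p∧x∉q⇒x∈p─q; x∈∁p⇒x∉p; x∉p⇒x∈∁p;
         p⊆q⇒∣p∣≤∣q∣; ∣p─q∣≤∣p∣; ∣p∣≤∣p∪q∣; p∩q≢∅⇒∣p─q∣<∣p∣;
         ∪-assoc; ∪-comm; ∪-identityˡ; ∪-identityʳ; ⊆-antisym)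
open import Data.Integer using (-[1+_]; _⊖_; 0ℤ)
open import Data.Integer.Properties using ([+m]-[+n]≡m⊖n; [1+m]⊖[1+n]≡m⊖n)
open import Data.List using (List; []; _∷_; _++_; length; map)
open import Data.List.Properties using (length-map; ++-assoc; ++-identityʳ)
open import Data.List.Membership.Propositional using () renaming (_∈_ to _∈ₗ_)
open import Data.List.Membership.Propositional.Properties
  using (∈-map⁺; ∈-map⁻; ∈-filter⁺; ∈-filter⁻; ∈-∃++; ∈-++⁻; ∈-++⁺ˡ; ∈-++⁺ʳ)
open import Data.List.Relation.Binary.Permutation.Propositional as ↭
  using (_↭_; ↭-refl; ↭-sym; ↭-trans; ↭-reflexive)
open import Data.List.Relation.Binary.Permutation.Propositional.Properties
  using (∈-resp-↭; ↭-length; shift)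
open import Data.List.Relation.Unary.Any using (here; there)
open import Data.List.Relation.Unary.Unique.Propositional using (Unique)
open import Data.Maybe using (Maybe; just; nothing)
open import Data.Maybe.Properties using (just-injective) renaming (≡-dec to ≡-decₘ)
open import Data.Nat using (ℕ; zero; suc; _+_; _*_; _∸_; _⊓_; _≤_; _<_; z≤n; s≤s; z<s)
open import Data.Nat.Properties
open import Data.Product using (Σ; ∃; _×_; _,_; proj₁; proj₂; map₂)
open import Data.Sum using (_⊎_; inj₁; inj₂; [_,_])
open import Data.Vec using ([]; _∷_; here; there; tabulate)
open import Data.Vec.Properties using (lookup∘tabulate; []=⇒lookup; lookup⇒[]=; ≡-dec)
open import Function using (_∘_; case_of_)
open import Level using (0ℓ)
open import Relation.Binary.Definitions using (DecidableEquality)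
open import Relation.Binary.PropositionalEquality hiding ([_])
open import Relation.Nullary using (yes; no; does)
open import Relation.Nullary.Decidable using (dec-true)
open import Relation.Unary using (Pred; Decidable)

-- Finite sets

∈-tabulate⁺ : ∀ {n} {P : Pred (Fin n) 0ℓ} (P? : Decidable P) {x} → P x → x ∈ tabulate (does ∘ P?)
∈-tabulate⁺ P? {x} px = lookup⇒[]= x _ (trans (lookup∘tabulate (does ∘ P?) x) (dec-true (P? x) px))

∈-tabulate⁻ : ∀ {n} {P : Pred (Fin n) 0ℓ} (P? : Decidable P) {x} → x ∈ tabulate (does ∘ P?) → P x
∈-tabulate⁻ P? {x} x∈ with P? x | trans (sym (lookup∘tabulate (does ∘ P?) x)) ([]=⇒lookup x∈)
... | yes px | _ = px
... | no _ | ()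

x∈p─q⇒x∉q : ∀ {n} {x : Fin n} (p q : Subset n) → x ∈ p ─ q → x ∉ q
x∈p─q⇒x∉q {x = zero} (_ ∷ p) (inside ∷ q) () here
x∈p─q⇒x∉q {x = zero} (_ ∷ p) (outside ∷ q) _ ()
x∈p─q⇒x∉q {x = suc x} (_ ∷ p) (_ ∷ q) (there x∈) (there x∈q) = x∈p─q⇒x∉q p q x∈ x∈q

0<∣p∣⇒Nonempty : ∀ {n} (p : Subset n) → 0 < ∣ p ∣ → Nonempty p
0<∣p∣⇒Nonempty (inside ∷ p) _ = zero , here
0<∣p∣⇒Nonempty (outside ∷ p) 0<∣p∣ with 0<∣p∣⇒Nonempty p 0<∣p∣
... | x , x∈p = suc x , there x∈p

∣p∪q∣≡∣q∣+∣p─q∣ : ∀ {n} (p q : Subset n) → ∣ p ∪ q ∣ ≡ ∣ q ∣ + ∣ p ─ q ∣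
∣p∪q∣≡∣q∣+∣p─q∣ [] [] = refl
∣p∪q∣≡∣q∣+∣p─q∣ (inside ∷ p) (inside ∷ q) = cong suc (∣p∪q∣≡∣q∣+∣p─q∣ p q)
∣p∪q∣≡∣q∣+∣p─q∣ (inside ∷ p) (outside ∷ q) = trans (cong suc (∣p∪q∣≡∣q∣+∣p─q∣ p q)) (sym (+-suc _ _))
∣p∪q∣≡∣q∣+∣p─q∣ (outside ∷ p) (inside ∷ q) = cong suc (∣p∪q∣≡∣q∣+∣p─q∣ p q)
∣p∪q∣≡∣q∣+∣p─q∣ (outside ∷ p) (outside ∷ q) = ∣p∪q∣≡∣q∣+∣p─q∣ p q

∣p∪q∣≤∣p∣+∣q∣ : ∀ {n} (p q : Subset n) → ∣ p ∪ q ∣ ≤ ∣ p ∣ + ∣ q ∣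
∣p∪q∣≤∣p∣+∣q∣ p q = begin
  ∣ p ∪ q ∣         ≡⟨ ∣p∪q∣≡∣q∣+∣p─q∣ p q ⟩
  ∣ q ∣ + ∣ p ─ q ∣ ≤⟨ +-monoʳ-≤ ∣ q ∣ (∣p─q∣≤∣p∣ p q) ⟩
  ∣ q ∣ + ∣ p ∣     ≡⟨ +-comm ∣ q ∣ ∣ p ∣ ⟩
  ∣ p ∣ + ∣ q ∣     ∎
  where open ≤-Reasoning

∣⁅x⁆∪p∣≡1+∣p∣ : ∀ {n} {x : Fin n} {p : Subset n} → x ∉ p → ∣ ⁅ x ⁆ ∪ p ∣ ≡ suc ∣ p ∣
∣⁅x⁆∪p∣≡1+∣p∣ {x = zero} {inside ∷ p} x∉p = ⊥-elim (x∉p here)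
∣⁅x⁆∪p∣≡1+∣p∣ {x = zero} {outside ∷ p} _ = cong (suc ∘ ∣_∣) (∪-identityˡ p)
∣⁅x⁆∪p∣≡1+∣p∣ {x = suc x} {inside ∷ p} x∉p = cong suc (∣⁅x⁆∪p∣≡1+∣p∣ (x∉p ∘ there))
∣⁅x⁆∪p∣≡1+∣p∣ {x = suc x} {outside ∷ p} x∉p = ∣⁅x⁆∪p∣≡1+∣p∣ (x∉p ∘ there)

∣p∣≤1+∣p-x∣ : ∀ {n} (p : Subset n) (x : Fin n) → ∣ p ∣ ≤ suc ∣ p - x ∣
∣p∣≤1+∣p-x∣ p x = begin
  ∣ p ∣               ≤⟨ ∣p∣≤∣p∪q∣ p ⁅ x ⁆ ⟩
  ∣ p ∪ ⁅ x ⁆ ∣       ≡⟨ ∣p∪q∣≡∣q∣+∣p─q∣ p ⁅ x ⁆ ⟩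
  ∣ ⁅ x ⁆ ∣ + ∣ p - x ∣ ≡⟨ cong (_+ ∣ p - x ∣) (∣⁅x⁆∣≡1 x) ⟩
  suc ∣ p - x ∣       ∎
  where open ≤-Reasoning

∣q∣<∣p∣⇒Nonempty[p─q] : ∀ {n} (p q : Subset n) → ∣ q ∣ < ∣ p ∣ → Nonempty (p ─ q)
∣q∣<∣p∣⇒Nonempty[p─q] p q ∣q∣<∣p∣ = 0<∣p∣⇒Nonempty (p ─ q) (+-cancelˡ-< ∣ q ∣ 0 _ (begin-strict
  ∣ q ∣ + 0         ≡⟨ +-identityʳ ∣ q ∣ ⟩
  ∣ q ∣             <⟨ ∣q∣<∣p∣ ⟩
  ∣ p ∣             ≤⟨ ∣p∣≤∣p∪q∣ p q ⟩
  ∣ p ∪ q ∣         ≡⟨ ∣p∪q∣≡∣q∣+∣p─q∣ p q ⟩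
  ∣ q ∣ + ∣ p ─ q ∣ ∎))
  where open ≤-Reasoning

⁅x⁆∪p⊆q : ∀ {n} {x : Fin n} {p q : Subset n} → x ∈ q → p ⊆ q → ⁅ x ⁆ ∪ p ⊆ q
⁅x⁆∪p⊆q {x = x} {p} x∈q p⊆q y∈ with x∈p∪q⁻ ⁅ x ⁆ p y∈
... | inj₁ y∈⁅x⁆ rewrite x∈⁅y⁆⇒x≡y x y∈⁅x⁆ = x∈q
... | inj₂ y∈p = p⊆q y∈p

extend-within : ∀ {n} {T F : Subset n} {k} → T ⊆ F → ∣ T ∣ ≤ k → k ≤ ∣ F ∣ →
                ∃ λ T′ → T ⊆ T′ × T′ ⊆ F × ∣ T′ ∣ ≡ k
extend-within {T = T} {F} {k} T⊆F ∣T∣≤k k≤∣F∣ =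
  let T′ , T⊆T′ , T′⊆F , ∣T′∣≡ = pad (k ∸ ∣ T ∣) T⊆F (subst (_≤ ∣ F ∣) (sym (m+[n∸m]≡n ∣T∣≤k)) k≤∣F∣)
  in T′ , T⊆T′ , T′⊆F , trans ∣T′∣≡ (m+[n∸m]≡n ∣T∣≤k)
  where
  pad : ∀ d {T} → T ⊆ F → ∣ T ∣ + d ≤ ∣ F ∣ → ∃ λ T′ → T ⊆ T′ × T′ ⊆ F × ∣ T′ ∣ ≡ ∣ T ∣ + d
  pad zero {T} T⊆F _ = T , (λ x∈ → x∈) , T⊆F , sym (+-identityʳ ∣ T ∣)
  pad (suc d) {T} T⊆F ∣T∣+1+d≤∣F∣ =
    let T′ , ⁅x⁆∪T⊆T′ , T′⊆F , ∣T′∣≡ = pad d (⁅x⁆∪p⊆q (p─q⊆p F T x∈F─T) T⊆F)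
                                           (subst (_≤ ∣ F ∣) (sym ∣⁅x⁆∪T∣+d) ∣T∣+1+d≤∣F∣)
    in T′ , ⁅x⁆∪T⊆T′ ∘ q⊆p∪q ⁅ x ⁆ T , T′⊆F , trans ∣T′∣≡ ∣⁅x⁆∪T∣+d
    where
    ∣T∣<∣F∣ : ∣ T ∣ < ∣ F ∣
    ∣T∣<∣F∣ = ≤-trans (m≤m+n (suc ∣ T ∣) d) (≤-trans (≤-reflexive (sym (+-suc ∣ T ∣ d))) ∣T∣+1+d≤∣F∣)
    x = proj₁ (∣q∣<∣p∣⇒Nonempty[p─q] F T ∣T∣<∣F∣)
    x∈F─T = proj₂ (∣q∣<∣p∣⇒Nonempty[p─q] F T ∣T∣<∣F∣)
    ∣⁅x⁆∪T∣+d : ∣ ⁅ x ⁆ ∪ T ∣ + d ≡ ∣ T ∣ + suc d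
    ∣⁅x⁆∪T∣+d = trans (cong (_+ d) (∣⁅x⁆∪p∣≡1+∣p∣ (x∈p─q⇒x∉q F T x∈F─T))) (sym (+-suc ∣ T ∣ d))

∈-⋃⁺ : ∀ {n} {ps : List (Subset n)} {p x} → p ∈ₗ ps → x ∈ p → x ∈ ⋃ ps
∈-⋃⁺ (here refl) x∈p = x∈p∪q⁺ (inj₁ x∈p)
∈-⋃⁺ (there p∈ps) x∈p = x∈p∪q⁺ (inj₂ (∈-⋃⁺ p∈ps x∈p))

∈-⋃⁻ : ∀ {n} (ps : List (Subset n)) {x} → x ∈ ⋃ ps → ∃ λ p → p ∈ₗ ps × x ∈ p
∈-⋃⁻ [] x∈ = ⊥-elim (∉⊥ x∈)
∈-⋃⁻ (p ∷ ps) x∈ with x∈p∪q⁻ p (⋃ ps) x∈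
... | inj₁ x∈p = p , here refl , x∈p
... | inj₂ x∈⋃ps = let q , q∈ps , x∈q = ∈-⋃⁻ ps x∈⋃ps in q , there q∈ps , x∈q

⋃-least : ∀ {n} {ps : List (Subset n)} {q} → (∀ {p} → p ∈ₗ ps → p ⊆ q) → ⋃ ps ⊆ q
⋃-least {ps = ps} ps⊆q x∈ = let p , p∈ps , x∈p = ∈-⋃⁻ ps x∈ in ps⊆q p∈ps x∈p

⋃-resp-↭ : ∀ {n} {ps qs : List (Subset n)} → ps ↭ qs → ⋃ ps ≡ ⋃ qs
⋃-resp-↭ ↭.refl = refl
⋃-resp-↭ (↭.prep p ps↭qs) = cong (p ∪_) (⋃-resp-↭ ps↭qs)
⋃-resp-↭ (↭.swap {xs = ps} {ys = qs} p q ps↭qs) = begin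
  p ∪ (q ∪ ⋃ ps) ≡⟨ ∪-assoc p q (⋃ ps) ⟨
  (p ∪ q) ∪ ⋃ ps ≡⟨ cong₂ _∪_ (∪-comm p q) (⋃-resp-↭ ps↭qs) ⟩
  (q ∪ p) ∪ ⋃ qs ≡⟨ ∪-assoc q p (⋃ qs) ⟩
  q ∪ (p ∪ ⋃ qs) ∎
  where open ≡-Reasoning
⋃-resp-↭ (↭.trans ps↭qs qs↭rs) = trans (⋃-resp-↭ ps↭qs) (⋃-resp-↭ qs↭rs)

∣⋃-map∣≤length : ∀ {n} {A : Set} (f : A → Subset n) → (∀ a → ∣ f a ∣ ≤ 1) →
                 (as : List A) → ∣ ⋃ (map f as) ∣ ≤ length as
∣⋃-map∣≤length {n} f ∣f∣≤1 [] = ≤-reflexive (∣⊥∣≡0 n)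
∣⋃-map∣≤length f ∣f∣≤1 (a ∷ as) =
  ≤-trans (∣p∪q∣≤∣p∣+∣q∣ (f a) _) (+-mono-≤ (∣f∣≤1 a) (∣⋃-map∣≤length f ∣f∣≤1 as))

elements : ∀ {n} → Subset n → List (Fin n)
elements [] = []
elements (inside ∷ p) = zero ∷ map suc (elements p)
elements (outside ∷ p) = map suc (elements p)

length-elements : ∀ {n} (p : Subset n) → length (elements p) ≡ ∣ p ∣
length-elements [] = refl
length-elements (inside ∷ p) = cong suc (trans (length-map suc (elements p)) (length-elements p))
length-elements (outside ∷ p) = trans (length-map suc (elements p)) (length-elements p)

∈-elements : ∀ {n} {p : Subset n} {x} → x ∈ p → x ∈ₗ elements p
∈-elements {p = inside ∷ p} here = here refl
∈-elements {p = inside ∷ p} (there x∈p) = there (∈-map⁺ suc (∈-elements x∈p))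
∈-elements {p = outside ∷ p} (there x∈p) = ∈-map⁺ suc (∈-elements x∈p)

pick : ∀ {n} → Subset n → Subset n
pick p with nonempty? p
... | yes (x , _) = ⁅ x ⁆
... | no _ = ⊥

pick-⊆ : ∀ {n} (p : Subset n) → pick p ⊆ p
pick-⊆ p with nonempty? p
... | yes (x , x∈p) = λ y∈⁅x⁆ → subst (_∈ p) (sym (x∈⁅y⁆⇒x≡y x y∈⁅x⁆)) x∈p
... | no _ = ⊥-elim ∘ ∉⊥

∣pick∣≤1 : ∀ {n} (p : Subset n) → ∣ pick p ∣ ≤ 1
∣pick∣≤1 {n} p with nonempty? p
... | yes (x , _) = ≤-reflexive (∣⁅x⁆∣≡1 x)
... | no _ = ≤-trans (≤-reflexive (∣⊥∣≡0 n)) z≤n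

pick-nonempty : ∀ {n} {p : Subset n} → Nonempty p → Nonempty (pick p)
pick-nonempty {p = p} p≢∅ with nonempty? p
... | yes (x , _) = x , x∈⁅x⁆ x
... | no p≡∅ = ⊥-elim (p≡∅ p≢∅)

-- Private sets

_≟ₛ_ : ∀ {n} → DecidableEquality (Subset n)
_≟ₛ_ = ≡-dec _≟ᵇ_

-- Each vertex has at most one owner, so the sets owned by distinct edges are disjoint.
Owner : ℕ → Set
Owner n = Fin n → Maybe (Subset n)

ownedBy : ∀ {n} → Owner n → Subset n → Subset n
ownedBy owner e = tabulate (does ∘ λ v → ≡-decₘ _≟ₛ_ (owner v) (just e))

module _ {n : ℕ} {owner : Owner n} {e : Subset n} {v : Fin n} where

  ∈-ownedBy⁺ : owner v ≡ just e → v ∈ ownedBy owner e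
  ∈-ownedBy⁺ = ∈-tabulate⁺ (λ v → ≡-decₘ _≟ₛ_ (owner v) (just e))

  ∈-ownedBy⁻ : v ∈ ownedBy owner e → owner v ≡ just e
  ∈-ownedBy⁻ = ∈-tabulate⁻ (λ v → ≡-decₘ _≟ₛ_ (owner v) (just e))

record PrivateSets {n : ℕ} (t : ℕ) (D : List (Subset n)) : Set where
  field
    owner : Owner n
    owner-sound : ∀ {v e} → owner v ≡ just e → v ∈ e × e ∈ₗ D
    owned-large : ∀ {e} → e ∈ₗ D → t ≤ ∣ ownedBy owner e ∣

open PrivateSets

nobody : ∀ {n t} → PrivateSets {n} t []
nobody = record { owner = λ _ → nothing ; owner-sound = λ () ; owned-large = λ () }

unowned-outside : ∀ {n t D} (ps : PrivateSets {n} t D) {v} → v ∉ ⋃ D → owner ps v ≡ nothing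
unowned-outside ps {v} v∉⋃D with owner ps v in owns
... | nothing = refl
... | just e = let v∈e , e∈D = owner-sound ps owns in ⊥-elim (v∉⋃D (∈-⋃⁺ e∈D v∈e))

PrivateSets-resp-↭ : ∀ {n t} {L D : List (Subset n)} → L ↭ D → PrivateSets t L → PrivateSets t D
PrivateSets-resp-↭ L↭D ps = record
  { owner = owner ps
  ; owner-sound = map₂ (∈-resp-↭ L↭D) ∘ owner-sound ps
  ; owned-large = owned-large ps ∘ ∈-resp-↭ (↭-sym L↭D)
  }

claim : ∀ {n} → Subset n → Subset n → Owner n → Owner n
claim g P owner v with v ∈? P
... | yes _ = just g
... | no _ = owner v

module _ {n : ℕ} {g P : Subset n} {owner : Owner n} {v : Fin n} where

  claim-∈ : v ∈ P → claim g P owner v ≡ just g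
  claim-∈ v∈P with v ∈? P
  ... | yes _ = refl
  ... | no v∉P = ⊥-elim (v∉P v∈P)

  claim-∉ : v ∉ P → claim g P owner v ≡ owner v
  claim-∉ v∉P with v ∈? P
  ... | yes v∈P = ⊥-elim (v∉P v∈P)
  ... | no _ = refl

extend : ∀ {n t g A} {P : Subset n} (ps : PrivateSets t A) → P ⊆ g →
         (∀ {v} → v ∈ P → owner ps v ≡ nothing) → t ≤ ∣ P ∣ → PrivateSets t (g ∷ A)
extend {t = t} {g} {A} {P} ps P⊆g P-unowned t≤∣P∣ = record
  { owner = new-owner ; owner-sound = sound ; owned-large = large }
  where
  new-owner : Owner _
  new-owner = claim g P (owner ps)

  sound : ∀ {v e} → new-owner v ≡ just e → v ∈ e × e ∈ₗ g ∷ A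
  sound {v} owns with v ∈? P
  ... | yes v∈P = subst (λ e → v ∈ e × e ∈ₗ g ∷ A) (just-injective owns) (P⊆g v∈P , here refl)
  ... | no _ = map₂ there (owner-sound ps owns)

  kept : ∀ {e} → ownedBy (owner ps) e ⊆ ownedBy new-owner e
  kept {e} {v} v∈ =
    ∈-ownedBy⁺ {owner = new-owner} (trans (claim-∉ v∉P) (∈-ownedBy⁻ {owner = owner ps} v∈))
    where
    v∉P : v ∉ P
    v∉P v∈P = case trans (sym (∈-ownedBy⁻ {owner = owner ps} v∈)) (P-unowned v∈P) of λ ()

  claimed : P ⊆ ownedBy new-owner g
  claimed v∈P = ∈-ownedBy⁺ {owner = new-owner} (claim-∈ v∈P)

  large : ∀ {e} → e ∈ₗ g ∷ A → t ≤ ∣ ownedBy new-owner e ∣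
  large (here refl) = ≤-trans t≤∣P∣ (p⊆q⇒∣p∣≤∣q∣ claimed)
  large (there e∈A) = ≤-trans (owned-large ps e∈A) (p⊆q⇒∣p∣≤∣q∣ kept)

-- Breaker's strategy

module BreakerStrategy {n : ℕ} (E : List (Subset n)) (m b : ℕ) {t : ℕ}
                       (1≤m : 1 ≤ m) (m≤b : m ≤ b) (m<t : m < t) (ps : PrivateSets t E) where

  open Game E m b hiding (BreakerWins)

  reserved : Subset n → Subset n
  reserved = ownedBy (owner ps)

  Blocked : Subset n → Subset n → Subset n → Set
  Blocked M B e = (∃ λ v → v ∈ reserved e × v ∈ B × v ∉ M) ⊎ (∀ {v} → v ∈ reserved e → v ∉ M)

  Safe : Subset n → Subset n → Set
  Safe M B = ∀ {e} → e ∈ₗ E → Blocked M B e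

  ∈Free⁻ : ∀ {M B x} → x ∈ Free M B → x ∉ M × x ∉ B
  ∈Free⁻ x∈ = (λ x∈M → x∈∁p⇒x∉p x∈ (x∈p∪q⁺ (inj₁ x∈M))) , (λ x∈B → x∈∁p⇒x∉p x∈ (x∈p∪q⁺ (inj₂ x∈B)))

  ∈Free⁺ : ∀ {M B x} → x ∉ M → x ∉ B → x ∈ Free M B
  ∈Free⁺ {M} {B} x∉M x∉B = x∉p⇒x∈∁p ([ x∉M , x∉B ] ∘ x∈p∪q⁻ M B)

  unclaimed : ∀ {M B S e} → Safe M B → S ⊆ Free M B → ∣ S ∣ ≤ m → e ∈ₗ E →
              ∃ λ v → v ∈ reserved e × v ∉ M ∪ S
  unclaimed {M} {B} {S} {e} safe S⊆F ∣S∣≤m e∈E with safe e∈E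
  ... | inj₁ (v , v∈ , v∈B , v∉M) =
    v , v∈ , [ v∉M , (λ v∈S → proj₂ (∈Free⁻ (S⊆F v∈S)) v∈B) ] ∘ x∈p∪q⁻ M S
  ... | inj₂ untouched =
    let v , v∈ = ∣q∣<∣p∣⇒Nonempty[p─q] (reserved e) S
                   (≤-trans (s≤s ∣S∣≤m) (≤-trans m<t (owned-large ps e∈E)))
    in v , p─q⊆p _ S v∈ , [ untouched (p─q⊆p _ S v∈) , x∈p─q⇒x∉q _ S v∈ ] ∘ x∈p∪q⁻ M S

  no-edge-after : ∀ {M B S} → Safe M B → S ⊆ Free M B → ∣ S ∣ ≤ m → NoEdgeIn (M ∪ S)
  no-edge-after safe S⊆F ∣S∣≤m e e∈E e⊆M∪S =
    let v , v∈ , v∉M∪S = unclaimed safe S⊆F ∣S∣≤m e∈E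
    in v∉M∪S (e⊆M∪S (proj₁ (owner-sound ps (∈-ownedBy⁻ {owner = owner ps} v∈))))

  Blocked-mono : ∀ {M B B′ e} → B ⊆ B′ → Blocked M B e → Blocked M B′ e
  Blocked-mono B⊆B′ (inj₁ (v , v∈ , v∈B , v∉M)) = inj₁ (v , v∈ , B⊆B′ v∈B , v∉M)
  Blocked-mono B⊆B′ (inj₂ untouched) = inj₂ untouched

  blocked-untouched : ∀ {M B S e} → Empty (reserved e ∩ S) → Blocked M B e → Blocked (M ∪ S) B e
  blocked-untouched {M} {S = S} e∩S≡∅ (inj₁ (v , v∈ , v∈B , v∉M)) =
    inj₁ (v , v∈ , v∈B , [ v∉M , (λ v∈S → e∩S≡∅ (v , x∈p∩q⁺ (v∈ , v∈S))) ] ∘ x∈p∪q⁻ M S)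
  blocked-untouched {M} {S = S} e∩S≡∅ (inj₂ untouched) =
    inj₂ λ v∈ → [ untouched v∈ , (λ v∈S → e∩S≡∅ (_ , x∈p∩q⁺ (v∈ , v∈S))) ] ∘ x∈p∪q⁻ M S

  module Answer {M B S : Subset n} (safe : Safe M B) (S⊆F : S ⊆ Free M B) (∣S∣≤m : ∣ S ∣ ≤ m) where

    F : Subset n
    F = Free (M ∪ S) B

    block : Maybe (Subset n) → Subset n
    block nothing = ⊥
    block (just e) = pick (reserved e ∩ F)

    T : Subset n
    T = ⋃ (map (block ∘ owner ps) (elements S))

    block⊆F : ∀ o → block o ⊆ F
    block⊆F nothing = ⊥-elim ∘ ∉⊥
    block⊆F (just e) = p∩q⊆q _ F ∘ pick-⊆ (reserved e ∩ F)

    ∣block∣≤1 : ∀ o → ∣ block o ∣ ≤ 1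
    ∣block∣≤1 nothing = ≤-trans (≤-reflexive (∣⊥∣≡0 n)) z≤n
    ∣block∣≤1 (just e) = ∣pick∣≤1 (reserved e ∩ F)

    T⊆F : T ⊆ F
    T⊆F = ⋃-least {ps = map (block ∘ owner ps) (elements S)} λ p∈ →
      let u , _ , p≡block = ∈-map⁻ (block ∘ owner ps) p∈ in subst (_⊆ F) (sym p≡block) (block⊆F (owner ps u))

    ∣T∣≤m : ∣ T ∣ ≤ m
    ∣T∣≤m = ≤-trans (∣⋃-map∣≤length (block ∘ owner ps) (∣block∣≤1 ∘ owner ps) (elements S))
                    (≤-trans (≤-reflexive (length-elements S)) ∣S∣≤m)

    safe-answer : Safe (M ∪ S) (B ∪ T)
    safe-answer {e} e∈E with nonempty? (reserved e ∩ S)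
    ... | no e∩S≡∅ = Blocked-mono (p⊆p∪q T) (blocked-untouched e∩S≡∅ (safe e∈E))
    ... | yes (u , u∈e∩S) with unclaimed safe S⊆F ∣S∣≤m e∈E
    ...   | v , v∈ , v∉M∪S with v ∈? B
    ...     | yes v∈B = inj₁ (v , v∈ , x∈p∪q⁺ (inj₁ v∈B) , v∉M∪S)
    ...     | no v∉B = inj₁ (w , w∈e , x∈p∪q⁺ (inj₂ w∈T) , proj₁ (∈Free⁻ w∈F))
      where
      u∈e = proj₁ (x∈p∩q⁻ (reserved e) S u∈e∩S)
      u∈S = proj₂ (x∈p∩q⁻ (reserved e) S u∈e∩S)
      w∈block = proj₂ (pick-nonempty (v , x∈p∩q⁺ (v∈ , ∈Free⁺ v∉M∪S v∉B)))
      w = proj₁ (pick-nonempty (v , x∈p∩q⁺ (v∈ , ∈Free⁺ v∉M∪S v∉B)))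
      w∈e = proj₁ (x∈p∩q⁻ (reserved e) F (pick-⊆ (reserved e ∩ F) w∈block))
      w∈F = proj₂ (x∈p∩q⁻ (reserved e) F (pick-⊆ (reserved e ∩ F) w∈block))
      w∈T : w ∈ T
      w∈T = ∈-⋃⁺ (∈-map⁺ (block ∘ owner ps) (∈-elements u∈S))
                 (subst (λ o → w ∈ block o) (sym (∈-ownedBy⁻ {owner = owner ps} u∈e)) w∈block)

  breaker-wins-from : ∀ k {M B} → ∣ Free M B ∣ ≤ k → Safe M B → BreakerWinsMakerToMove M B
  breaker-answers : ∀ k {M B S} → ∣ Free M B ∣ ≤ suc k → 0 < ∣ Free M B ∣ → Safe M B →
                    S ⊆ Free M B → ∣ S ∣ ≡ m ⊓ ∣ Free M B ∣ → BreakerWinsBreakerToMove (M ∪ S) B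

  breaker-wins-from k {M} {B} ∣F∣≤k safe with ∣ Free M B ∣ ≟ 0
  ... | yes ∣F∣≡0 = over ∣F∣≡0 (subst NoEdgeIn (∪-identityʳ M)
                      (no-edge-after safe (⊥-elim ∘ ∉⊥) (≤-trans (≤-reflexive (∣⊥∣≡0 n)) z≤n)))
  breaker-wins-from zero ∣F∣≤0 safe | no ∣F∣≢0 = ⊥-elim (∣F∣≢0 (n≤0⇒n≡0 ∣F∣≤0))
  breaker-wins-from (suc k) ∣F∣≤1+k safe | no ∣F∣≢0 =
    move (n≢0⇒n>0 ∣F∣≢0) λ S → breaker-answers k ∣F∣≤1+k (n≢0⇒n>0 ∣F∣≢0) safe

  breaker-answers k {M} {B} {S} ∣F∣≤1+k 0<∣F∣ safe S⊆F ∣S∣≡ = case ∣ F ∣ ≟ 0 of λ where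
      (yes ∣F∣≡0) → over ∣F∣≡0 (no-edge-after safe S⊆F ∣S∣≤m)
      (no ∣F∣≢0) → move (n≢0⇒n>0 ∣F∣≢0)
        (T′ , T′⊆F , ∣T′∣≡ , breaker-wins-from k ∣F″∣≤k (Blocked-mono B∪T⊆B∪T′ ∘ safe-answer))
    where
    ∣S∣≤m : ∣ S ∣ ≤ m
    ∣S∣≤m = ≤-trans (≤-reflexive ∣S∣≡) (m⊓n≤m m _)
    open Answer safe S⊆F ∣S∣≤m
    extended = extend-within T⊆F (⊓-glb (≤-trans ∣T∣≤m m≤b) (p⊆q⇒∣p∣≤∣q∣ T⊆F)) (m⊓n≤n b ∣ F ∣)
    T′ = proj₁ extended
    T⊆T′ = proj₁ (proj₂ extended)
    T′⊆F = proj₁ (proj₂ (proj₂ extended))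
    ∣T′∣≡ = proj₂ (proj₂ (proj₂ extended))
    B∪T⊆B∪T′ : B ∪ T ⊆ B ∪ T′
    B∪T⊆B∪T′ = [ p⊆p∪q T′ , q⊆p∪q B T′ ∘ T⊆T′ ] ∘ x∈p∪q⁻ B T
    S≢∅ : Nonempty S
    S≢∅ = 0<∣p∣⇒Nonempty S (subst (0 <_) (sym ∣S∣≡) (⊓-glb 1≤m 0<∣F∣))
    shrinks : Free (M ∪ S) (B ∪ T′) ⊆ Free M B ─ S
    shrinks x∈ = let x∉M∪S , x∉B∪T′ = ∈Free⁻ x∈ in
      x∈p∧x∉q⇒x∈p─q (∈Free⁺ (x∉M∪S ∘ x∈p∪q⁺ ∘ inj₁) (x∉B∪T′ ∘ x∈p∪q⁺ ∘ inj₁)) (x∉M∪S ∘ x∈p∪q⁺ ∘ inj₂)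
    ∣F″∣≤k : ∣ Free (M ∪ S) (B ∪ T′) ∣ ≤ k
    ∣F″∣≤k = ≤-pred (≤-trans (s≤s (p⊆q⇒∣p∣≤∣q∣ shrinks))
                    (≤-trans (p∩q≢∅⇒∣p─q∣<∣p∣ (Free M B) S
                                (proj₁ S≢∅ , x∈p∩q⁺ (S⊆F (proj₂ S≢∅) , proj₂ S≢∅)))
                             ∣F∣≤1+k))

  breaker-wins : BreakerWins E m b
  breaker-wins = breaker-wins-from n (∣p∣≤n (Free ⊥ ⊥)) λ _ → inj₂ λ _ → ∉⊥

-- Private sets in trees and unicycles

+-tight : ∀ {x y a b} → x ≤ a → y ≤ b → x + y ≡ a + b → x ≡ a × y ≡ b
+-tight {x} {y} {a} {b} x≤a y≤b x+y≡a+b =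
  x≡a , +-cancelˡ-≡ a y b (trans (cong (_+ y) (sym x≡a)) x+y≡a+b)
  where
  x≡a : x ≡ a
  x≡a = ≤-antisym x≤a (+-cancelʳ-≤ b a x (subst (_≤ x + b) x+y≡a+b (+-monoʳ-≤ x y≤b)))

+-slack : ∀ {x y a b} → x ≤ suc a → y ≤ b → x + y ≡ a + b → (x ≡ a × y ≡ b) ⊎ (x ≡ suc a × suc y ≡ b)
+-slack {x} {y} {a} {b} x≤1+a y≤b x+y≡a+b with x ≤? a
... | yes x≤a = inj₁ (+-tight x≤a y≤b x+y≡a+b)
... | no x≰a =
  inj₂ (x≡1+a , +-cancelˡ-≡ a (suc y) b (trans (+-suc a y) (trans (cong (_+ y) (sym x≡1+a)) x+y≡a+b)))
  where
  x≡1+a : x ≡ suc a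
  x≡1+a = ≤-antisym x≤1+a (≰⇒> x≰a)

*-sucʳ : ∀ t a → t * suc a ≡ t * a + t
*-sucʳ t a = trans (*-suc t a) (+-comm t (t * a))

-- Edges are listed latest first.
data Growing {n : ℕ} : List (Subset n) → Set where
  start : ∀ g → Growing (g ∷ [])
  grow : ∀ {g A} → Nonempty (g ∩ ⋃ A) → Growing A → Growing (g ∷ A)

∣p∪⊥∣≡∣p∣ : ∀ {n} (p : Subset n) → ∣ p ∪ ⊥ ∣ ≡ ∣ p ∣
∣p∪⊥∣≡∣p∣ p = cong ∣_∣ (∪-identityʳ p)

new-vertices-≤ : ∀ {n t} {g : Subset n} {A} → ∣ g ∣ ≡ suc t → Nonempty (g ∩ ⋃ A) → ∣ g ─ ⋃ A ∣ ≤ t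
new-vertices-≤ {g = g} {A} ∣g∣≡1+t meet =
  ≤-pred (subst (∣ g ─ ⋃ A ∣ <_) ∣g∣≡1+t (p∩q≢∅⇒∣p─q∣<∣p∣ g (⋃ A) meet))

∣⋃∣-growing : ∀ {n t} {L : List (Subset n)} → Uniform (suc t) L → Growing L →
              ∣ ⋃ L ∣ ≤ suc (t * length L)
∣⋃∣-growing {t = t} uniform (start g) = ≤-reflexive (begin
  ∣ g ∪ ⊥ ∣    ≡⟨ ∣p∪⊥∣≡∣p∣ g ⟩
  ∣ g ∣        ≡⟨ uniform g (here refl) ⟩
  suc t        ≡⟨ cong suc (*-identityʳ t) ⟨
  suc (t * 1)  ∎)
  where open ≡-Reasoning
∣⋃∣-growing {t = t} uniform (grow {g} {A} meet growingA) = begin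
  ∣ g ∪ ⋃ A ∣                 ≡⟨ ∣p∪q∣≡∣q∣+∣p─q∣ g (⋃ A) ⟩
  ∣ ⋃ A ∣ + ∣ g ─ ⋃ A ∣       ≤⟨ +-mono-≤ (∣⋃∣-growing (λ e → uniform e ∘ there) growingA)
                                          (new-vertices-≤ {A = A} (uniform g (here refl)) meet) ⟩
  suc (t * length A) + t      ≡⟨ cong suc (*-sucʳ t (length A)) ⟨
  suc (t * suc (length A))    ∎
  where open ≤-Reasoning

extend-new : ∀ {n t g A} {Q : Subset n} (ps : PrivateSets t A) → Q ⊆ g ─ ⋃ A → t ≤ ∣ Q ∣ →
             PrivateSets t (g ∷ A)
extend-new {g = g} {A} ps Q⊆new =
  extend ps (p─q⊆p g (⋃ A) ∘ Q⊆new) (unowned-outside ps ∘ x∈p─q⇒x∉q g (⋃ A) ∘ Q⊆new)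

extend-via : ∀ {n t g A w} {Q : Subset n} (ps : PrivateSets t A) → owner ps w ≡ nothing →
             w ∈ g → w ∈ ⋃ A → Q ⊆ g ─ ⋃ A → t ≤ suc ∣ Q ∣ → PrivateSets t (g ∷ A)
extend-via {t = t} {g} {A} {w} {Q} ps w-free w∈g w∈⋃A Q⊆new t≤1+∣Q∣ =
  extend ps (⁅x⁆∪p⊆q w∈g (p─q⊆p g (⋃ A) ∘ Q⊆new)) unowned
         (subst (t ≤_) (sym (∣⁅x⁆∪p∣≡1+∣p∣ w∉Q)) t≤1+∣Q∣)
  where
  w∉Q : w ∉ Q
  w∉Q w∈Q = x∈p─q⇒x∉q g (⋃ A) (Q⊆new w∈Q) w∈⋃A
  unowned : ∀ {v} → v ∈ ⁅ w ⁆ ∪ Q → owner ps v ≡ nothing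
  unowned v∈ with x∈p∪q⁻ ⁅ w ⁆ Q v∈
  ... | inj₁ v∈⁅w⁆ rewrite x∈⁅y⁆⇒x≡y w v∈⁅w⁆ = w-free
  ... | inj₂ v∈Q = unowned-outside ps (x∈p─q⇒x∉q g (⋃ A) (Q⊆new v∈Q))

-- Tightness forces every later edge to bring exactly t new vertices, and the root r can be
-- moved: if r is new in g, g gives up r and takes the vertex it shares with the earlier edges.
tree-private : ∀ {n t} {L : List (Subset n)} → Uniform (suc t) L → Growing L →
               ∣ ⋃ L ∣ ≡ suc (t * length L) → ∀ r → Σ (PrivateSets t L) λ ps → owner ps r ≡ nothing
tree-private {t = t} uniform (start g) _ r =
  extend nobody (p─q⊆p g ⁅ r ⁆) (λ _ → refl) t≤∣g-r∣ ,
  claim-∉ (λ r∈g-r → x∈p─q⇒x∉q g ⁅ r ⁆ r∈g-r (x∈⁅x⁆ r))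
  where
  t≤∣g-r∣ : t ≤ ∣ g - r ∣
  t≤∣g-r∣ = ≤-pred (subst (_≤ suc ∣ g - r ∣) (uniform g (here refl)) (∣p∣≤1+∣p-x∣ g r))
tree-private {t = t} uniform (grow {g} {A} (w , w∈g∩⋃A) growingA) ∣⋃L∣≡ r = case r ∈? ⋃ A of λ where
    (yes r∈⋃A) →
      let ps , r-free = tree-private uniformA growingA tightA r
      in extend-new ps (λ v∈ → v∈) (≤-reflexive (sym ∣new∣≡t)) ,
         trans (claim-∉ λ r∈new → x∈p─q⇒x∉q g (⋃ A) r∈new r∈⋃A) r-free
    (no r∉⋃A) →
      let ps , w-free = tree-private uniformA growingA tightA w
      in extend-via ps w-free w∈g w∈⋃A (p─q⊆p (g ─ ⋃ A) ⁅ r ⁆)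
                    (subst (_≤ suc ∣ g ─ ⋃ A - r ∣) ∣new∣≡t (∣p∣≤1+∣p-x∣ (g ─ ⋃ A) r)) ,
         trans (claim-∉ ([ (λ r∈⁅w⁆ → r∉⋃A (subst (_∈ ⋃ A) (sym (x∈⁅y⁆⇒x≡y w r∈⁅w⁆)) w∈⋃A)) ,
                          (λ r∈new-r → x∈p─q⇒x∉q (g ─ ⋃ A) ⁅ r ⁆ r∈new-r (x∈⁅x⁆ r)) ] ∘ x∈p∪q⁻ ⁅ w ⁆ _))
               (unowned-outside ps r∉⋃A)
  where
  uniformA : Uniform (suc t) A
  uniformA e = uniform e ∘ there
  w∈g = proj₁ (x∈p∩q⁻ g (⋃ A) w∈g∩⋃A)
  w∈⋃A = proj₂ (x∈p∩q⁻ g (⋃ A) w∈g∩⋃A)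
  tight = +-tight (∣⋃∣-growing uniformA growingA)
                  (new-vertices-≤ {A = A} (uniform g (here refl)) (w , w∈g∩⋃A))
                  (trans (sym (∣p∪q∣≡∣q∣+∣p─q∣ g (⋃ A))) (trans ∣⋃L∣≡ (cong suc (*-sucʳ t (length A)))))
  tightA = proj₁ tight
  ∣new∣≡t = proj₂ tight

unicycle-private : ∀ {n t} {L : List (Subset n)} → Uniform (suc t) L → Growing L →
                   ∣ ⋃ L ∣ ≡ t * length L → PrivateSets t L
unicycle-private {t = t} uniform (start g) ∣g∪⊥∣≡t*1 = ⊥-elim (1+n≢n (begin
  suc t    ≡⟨ uniform g (here refl) ⟨
  ∣ g ∣    ≡⟨ ∣p∪⊥∣≡∣p∣ g ⟨
  ∣ g ∪ ⊥ ∣ ≡⟨ ∣g∪⊥∣≡t*1 ⟩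
  t * 1    ≡⟨ *-identityʳ t ⟩
  t        ∎))
  where open ≡-Reasoning
unicycle-private {t = t} uniform (grow {g} {A} (w , w∈g∩⋃A) growingA) ∣⋃L∣≡ = case slack of λ where
    (inj₁ (unicyclicA , ∣new∣≡t)) →
      extend-new (unicycle-private uniformA growingA unicyclicA) (λ v∈ → v∈) (≤-reflexive (sym ∣new∣≡t))
    (inj₂ (tightA , 1+∣new∣≡t)) →
      let ps , w-free = tree-private uniformA growingA tightA w
      in extend-via ps w-free w∈g w∈⋃A (λ v∈ → v∈) (≤-reflexive (sym 1+∣new∣≡t))
  where
  uniformA : Uniform (suc t) A
  uniformA e = uniform e ∘ there
  w∈g = proj₁ (x∈p∩q⁻ g (⋃ A) w∈g∩⋃A)
  w∈⋃A = proj₂ (x∈p∩q⁻ g (⋃ A) w∈g∩⋃A)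
  slack = +-slack (∣⋃∣-growing uniformA growingA)
                  (new-vertices-≤ {A = A} (uniform g (here refl)) (w , w∈g∩⋃A))
                  (trans (sym (∣p∪q∣≡∣q∣+∣p─q∣ g (⋃ A))) (trans ∣⋃L∣≡ (*-sucʳ t (length A))))

-- Growing orders of connected hypergraphs

rest-meets-⋃ : ∀ {n} {D A R : List (Subset n)} → (∀ {e} → e ∈ₗ D → e ∈ₗ A ⊎ e ∈ₗ R) →
               ∀ {x y r} → EdgeChain D x y → x ∈ ⋃ A → r ∈ₗ R → y ∈ r →
               ∃ λ g → g ∈ₗ R × Nonempty (g ∩ ⋃ A)
rest-meets-⋃ split (one e∈D x∈e y∈e) x∈⋃A r∈R y∈r with split e∈D
... | inj₁ e∈A = _ , r∈R , _ , x∈p∩q⁺ (y∈r , ∈-⋃⁺ e∈A y∈e)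
... | inj₂ e∈R = _ , e∈R , _ , x∈p∩q⁺ (x∈e , x∈⋃A)
rest-meets-⋃ split (cons e∈D x∈e z∈e chain) x∈⋃A r∈R y∈r with split e∈D
... | inj₁ e∈A = rest-meets-⋃ split chain (∈-⋃⁺ e∈A z∈e) r∈R y∈r
... | inj₂ e∈R = _ , e∈R , _ , x∈p∩q⁺ (x∈e , x∈⋃A)

growing-order : ∀ {n} {V : Subset n} {D} → Connected V D → (∀ {e} → e ∈ₗ D → e ⊆ V) →
                (∀ {e} → e ∈ₗ D → Nonempty e) →
                ∀ k {A R} → length R ≡ k → Growing A → A ++ R ↭ D → ∃ λ L → Growing L × L ↭ D
growing-order _ _ _ _ {A} {[]} _ growingA A↭D = A , growingA , subst (_↭ _) (++-identityʳ A) A↭D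
growing-order {D = D} conn D⊆V nonempty (suc k) {A} {r ∷ R} ∣R∣≡1+k growingA A++R↭D =
  let a , a∈A = head∈ growingA
      x , x∈a = nonempty (∈D (∈-++⁺ˡ a∈A))
      y , y∈r = nonempty (∈D (∈-++⁺ʳ A (here refl)))
      g , g∈R , meet = rest-meets-⋃ split (conn x y (D⊆V (∈D (∈-++⁺ˡ a∈A)) x∈a)
                                                  (D⊆V (∈D (∈-++⁺ʳ A (here refl))) y∈r))
                                    (∈-⋃⁺ a∈A x∈a) (here refl) y∈r
      ys , zs , R≡ = ∈-∃++ g∈R
  in growing-order conn D⊆V nonempty k
       (suc-injective (trans (sym (↭-length (shift g ys zs))) (trans (cong length (sym R≡)) ∣R∣≡1+k)))
       (grow meet growingA)
       (↭-trans (↭-reflexive (cong (g ∷_) (sym (++-assoc A ys zs))))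
       (↭-trans (↭-sym (shift g (A ++ ys) zs))
       (↭-trans (↭-reflexive (trans (++-assoc A ys (g ∷ zs)) (cong (A ++_) (sym R≡)))) A++R↭D)))
  where
  head∈ : ∀ {A} → Growing A → ∃ λ a → a ∈ₗ A
  head∈ (start g) = g , here refl
  head∈ (grow {g} _ _) = g , here refl
  ∈D : ∀ {e} → e ∈ₗ A ++ r ∷ R → e ∈ₗ D
  ∈D = ∈-resp-↭ A++R↭D
  split : ∀ {e} → e ∈ₗ D → e ∈ₗ A ⊎ e ∈ₗ r ∷ R
  split = ∈-++⁻ A ∘ ∈-resp-↭ (↭-sym A++R↭D)

⋃≡vertices : ∀ {n} {V : Subset n} {D} → Connected V D → (∀ {e} → e ∈ₗ D → e ⊆ V) → ⋃ D ≡ V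
⋃≡vertices {D = D} conn D⊆V = ⊆-antisym (⋃-least D⊆V) λ {x} x∈V → chain-start (conn x x x∈V x∈V)
  where
  chain-start : ∀ {x y} → EdgeChain D x y → x ∈ ⋃ D
  chain-start (one e∈D x∈e _) = ∈-⋃⁺ e∈D x∈e
  chain-start (cons e∈D x∈e _ _) = ∈-⋃⁺ e∈D x∈e

uniform-nonempty : ∀ {n t} {D : List (Subset n)} → Uniform (suc t) D → ∀ {e} → e ∈ₗ D → Nonempty e
uniform-nonempty uniform {e} e∈D = 0<∣p∣⇒Nonempty e (subst (0 <_) (sym (uniform e e∈D)) z<s)

connected-private : ∀ {n t} {V : Subset n} {D} → Uniform (suc t) D → Connected V D →
                    (∀ {e} → e ∈ₗ D → e ⊆ V) → ∣ V ∣ ≡ suc (t * length D) ⊎ ∣ V ∣ ≡ t * length D →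
                    PrivateSets t D
connected-private {D = []} _ _ _ _ = nobody
connected-private {t = t} {V} {g ∷ D′} uniform conn D⊆V size
  with growing-order conn D⊆V (uniform-nonempty uniform) (length D′) refl (start g) ↭-refl
... | L , growingL , L↭D = PrivateSets-resp-↭ L↭D ([ from-tree , from-unicycle ] size)
  where
  uniformL : Uniform (suc t) L
  uniformL e = uniform e ∘ ∈-resp-↭ L↭D
  ∣⋃L∣≡∣V∣ : ∣ ⋃ L ∣ ≡ ∣ V ∣
  ∣⋃L∣≡∣V∣ = cong ∣_∣ (trans (⋃-resp-↭ L↭D) (⋃≡vertices conn D⊆V))
  ∣L∣≡∣D∣ : length L ≡ suc (length D′)
  ∣L∣≡∣D∣ = ↭-length L↭D
  from-tree : ∣ V ∣ ≡ suc (t * length (g ∷ D′)) → PrivateSets t L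
  from-tree ∣V∣≡ = proj₁ (tree-private uniformL growingL
                            (trans ∣⋃L∣≡∣V∣ (trans ∣V∣≡ (cong (λ l → suc (t * l)) (sym ∣L∣≡∣D∣))))
                            (proj₁ (uniform-nonempty uniform (here refl))))
  from-unicycle : ∣ V ∣ ≡ t * length (g ∷ D′) → PrivateSets t L
  from-unicycle ∣V∣≡ = unicycle-private uniformL growingL
                         (trans ∣⋃L∣≡∣V∣ (trans ∣V∣≡ (cong (t *_) (sym ∣L∣≡∣D∣))))

m⊖n≡0⇒m≡n : ∀ m n → m ⊖ n ≡ 0ℤ → m ≡ n
m⊖n≡0⇒m≡n zero zero _ = refl
m⊖n≡0⇒m≡n (suc m) (suc n) eq = cong suc (m⊖n≡0⇒m≡n m n (trans (sym ([1+m]⊖[1+n]≡m⊖n m n)) eq))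

m⊖n≡-1⇒n≡1+m : ∀ m n → m ⊖ n ≡ -[1+ 0 ] → n ≡ suc m
m⊖n≡-1⇒n≡1+m zero (suc zero) _ = refl
m⊖n≡-1⇒n≡1+m (suc m) (suc n) eq = cong suc (m⊖n≡-1⇒n≡1+m m n (trans (sym ([1+m]⊖[1+n]≡m⊖n m n)) eq))

tree-size : ∀ {n} t (V : Subset n) (D : List (Subset n)) →
            excess (suc t) V D ≡ -[1+ 0 ] → ∣ V ∣ ≡ suc (t * length D)
tree-size t V D excess≡-1 =
  m⊖n≡-1⇒n≡1+m (t * length D) ∣ V ∣ (trans (sym ([+m]-[+n]≡m⊖n (t * length D) ∣ V ∣)) excess≡-1)

unicycle-size : ∀ {n} t (V : Subset n) (D : List (Subset n)) →
                excess (suc t) V D ≡ 0ℤ → ∣ V ∣ ≡ t * length D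
unicycle-size t V D excess≡0 =
  sym (m⊖n≡0⇒m≡n (t * length D) ∣ V ∣ (trans (sym ([+m]-[+n]≡m⊖n (t * length D) ∣ V ∣)) excess≡0))

component-private : ∀ {n t} {V : Subset n} {D} → (∀ {e} → e ∈ₗ D → e ⊆ V) →
                    IsTree (suc t) V D ⊎ IsUnicycle (suc t) V D → PrivateSets t D
component-private {t = t} {V} {D} D⊆V (inj₁ (uniform , conn , excess≡-1)) =
  connected-private uniform conn D⊆V (inj₁ (tree-size t V D excess≡-1))
component-private {t = t} {V} {D} D⊆V (inj₂ (uniform , conn , excess≡0)) =
  connected-private uniform conn D⊆V (inj₂ (unicycle-size t V D excess≡0))

glue-private : ∀ {n k t} {E : List (Subset n)} (c : Fin n → Fin k) →
               (∀ e → e ∈ₗ E → ∃ λ i → e ⊆ Part c i) →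
               (∀ i → PrivateSets t (PartEdges E c i)) → PrivateSets t E
glue-private {t = t} {E} c covered ps =
  record { owner = owner′ ; owner-sound = sound ; owned-large = large }
  where
  owner′ : Owner _
  owner′ v = owner (ps (c v)) v
  sound : ∀ {v e} → owner′ v ≡ just e → v ∈ e × e ∈ₗ E
  sound {v} owns = map₂ (proj₁ ∘ ∈-filter⁻ (_⊆? Part c (c v)) {xs = E}) (owner-sound (ps (c v)) owns)
  large : ∀ {e} → e ∈ₗ E → t ≤ ∣ ownedBy owner′ e ∣
  large {e} e∈E with covered e e∈E
  ... | i , e⊆Vᵢ =
    ≤-trans (owned-large (ps i) (∈-filter⁺ (_⊆? Part c i) e∈E e⊆Vᵢ)) (p⊆q⇒∣p∣≤∣q∣ local⊆global)
    where
    local⊆global : ownedBy (owner (ps i)) e ⊆ ownedBy owner′ e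
    local⊆global {v} v∈ =
      ∈-ownedBy⁺ {owner = owner′} (subst (λ j → owner (ps j) v ≡ just e) (sym cv≡i) owns)
      where
      owns = ∈-ownedBy⁻ {owner = owner (ps i)} v∈
      cv≡i : c v ≡ i
      cv≡i = ∈-tabulate⁻ (λ u → c u ≟ᶠ i) (e⊆Vᵢ (proj₁ (owner-sound (ps i) owns)))

lemma2 : (m b s n : ℕ) → 1 ≤ m → 1 ≤ b → 1 ≤ s → m ≤ s ∸ 2 → m ≤ b →
         (E : List (Subset n)) → Unique E → Uniform s E →
         UnionOfTreesAndUnicycles s E →
         BreakerWins E m b
lemma2 m b zero n _ _ () _ _ _ _ _ _
lemma2 m b (suc t) n 1≤m _ _ m≤t∸1 m≤b E _ _ (k , c , covered , shape) =
  BreakerStrategy.breaker-wins E m b 1≤m m≤b (m<u t m≤t∸1)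
    (glue-private c covered λ i →
      component-private (proj₂ ∘ ∈-filter⁻ (_⊆? Part c i) {xs = E}) (shape i))
  where
  m<u : ∀ u → m ≤ u ∸ 1 → m < u
  m<u zero m≤0 = ⊥-elim (<⇒≱ 1≤m m≤0)
  m<u (suc u) m≤u = s≤s m≤u
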